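{- Let $(L;\wedge,\vee,^{\Delta},^{\nabla},0,1)$ be a weakly dicomplemented lattice. For $a\in L$ let $S[a)$ be the smallest S-filter of $L$ containing $a$, and let $SF_p(L)=\{S[a)\mid a\in L\}$. Define $S[a)^{\perp}=S[a^{\Delta})$. Then $SF_p(L)$, with the operations $\cap$ (intersection) and $\underline{\vee}$ (the join in the lattice of S-filters of $L$ ordered by inclusion), the unary operation $^{\perp}$, and constants $S[1)=\{1\}$ and $S[0)=L$, is an ortholattice, and it is isomorphic (as an ortholattice) to $(\overline{S}(L);\overline{\sqcap},\vee,^{\Delta},0,1)$.
   Context: A weakly dicomplemented lattice (WDL) is an algebra $(L;\wedge,\vee,^{\Delta},^{\nabla},0,1)$ such that $(L;\wedge,\vee,0,1)$ is a bounded lattice and, for all $x,y\in L$: $x^{\Delta\Delta}\le x$; $x\le y\Rightarrow y^{\Delta}\le x^{\Delta}$; $(x\wedge y)\vee(x\wedge y^{\Delta})=x$; $x^{\nabla\nabla}\ge x$; $x\le y\Rightarrow y^{\nabla}\le x^{\nabla}$; $(x\vee y)\wedge(x\vee y^{\nabla})=x$. A filter of $L$ is a nonempty upward closed subset closed under $\wedge$. $\overline{S}(L)=\{x\in L\mid x^{\Delta\Delta}=x\}$ and $x\,\overline{\sqcap}\,y=(x^{\Delta}\vee y^{\Delta})^{\Delta}$. An S-filter of $L$ is a filter $F$ of $L$ with $x\,\overline{\sqcap}\,y\in F$ whenever $x,y\in F$. An ortholattice is a bounded lattice with an order-reversing involution $^{\perp}$ with $a\vee a^{\perp}=1$ and $a\wedge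 a^{\perp}=0$. -}

module Defs where

open import Level using (Level; _⊔_; suc)
open import Algebra.Core using (Op₁; Op₂)
open import Algebra.Lattice.Structures using (IsLattice)
open import Data.Product using (Σ; ∃; ∃-syntax; _×_; _,_; proj₁; proj₂)
open import Data.Sum using (_⊎_)
open import Relation.Binary.Core using (Rel)
open import Relation.Binary.PropositionalEquality using (_≡_)
open import Relation.Unary using (Pred; _∈_; _⊆_; _≐_; _∩_; _∪_; ｛_｝; U)

record IsOrtholattice {a ℓ} {A : Set a} (_≈_ : Rel A ℓ)
                      (_∧_ _∨_ : Op₂ A) (_⊥ : Op₁ A) (𝟘 𝟙 : A)
                      : Set (a ⊔ ℓ) where
  field
    isLattice     : IsLattice _≈_ _∨_ _∧_
    ⊥-cong        : ∀ {x y} → x ≈ y → (x ⊥) ≈ (y ⊥)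
    𝟘-least       : ∀ x → (𝟘 ∧ x) ≈ 𝟘
    𝟙-greatest    : ∀ x → (x ∧ 𝟙) ≈ x
    ⊥-involutive  : ∀ x → ((x ⊥) ⊥) ≈ x
    ⊥-antitone    : ∀ x y → (x ∧ y) ≈ x → ((y ⊥) ∧ (x ⊥)) ≈ (y ⊥)
    ∨-complement  : ∀ x → (x ∨ (x ⊥)) ≈ 𝟙
    ∧-complement  : ∀ x → (x ∧ (x ⊥)) ≈ 𝟘

record IsOrthoIso {a ℓa b ℓb} {A : Set a} {B : Set b}
                  (_≈A_ : Rel A ℓa) (_∧A_ _∨A_ : Op₂ A) (_⊥A : Op₁ A) (𝟘A 𝟙A : A)
                  (_≈B_ : Rel B ℓb) (_∧B_ _∨B_ : Op₂ B) (_⊥B : Op₁ B) (𝟘B 𝟙B : B)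
                  (f : A → B) : Set (a ⊔ ℓa ⊔ b ⊔ ℓb) where
  field
    cong        : ∀ {x y} → x ≈A y → f x ≈B f y
    injective   : ∀ {x y} → f x ≈B f y → x ≈A y
    surjective  : ∀ y → ∃[ x ] (f x ≈B y)
    hom-∧       : ∀ x y → f (x ∧A y) ≈B (f x ∧B f y)
    hom-∨       : ∀ x y → f (x ∨A y) ≈B (f x ∨B f y)
    hom-⊥       : ∀ x → f (x ⊥A) ≈B (f x ⊥B)
    hom-𝟘       : f 𝟘A ≈B 𝟘B
    hom-𝟙       : f 𝟙A ≈B 𝟙B

record WDL (ℓ : Level) : Set (suc ℓ) where
  infixr 7 _∧_
  infixr 6 _∨_
  infix  4 _≤_
  field
    Carrier   : Set ℓ
    _∧_ _∨_   : Op₂ Carrier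
    _Δ _∇     : Op₁ Carrier
    𝟘 𝟙       : Carrier
    isLattice : IsLattice _≡_ _∨_ _∧_

  _≤_ : Carrier → Carrier → Set ℓ
  x ≤ y = x ∧ y ≡ x

  field
    𝟘-least    : ∀ x → 𝟘 ≤ x
    𝟙-greatest : ∀ x → x ≤ 𝟙
    Δ1 : ∀ x → (x Δ) Δ ≤ x
    Δ2 : ∀ x y → x ≤ y → y Δ ≤ x Δ
    Δ3 : ∀ x y → (x ∧ y) ∨ (x ∧ y Δ) ≡ x
    ∇1 : ∀ x → x ≤ (x ∇) ∇
    ∇2 : ∀ x y → x ≤ y → y ∇ ≤ x ∇
    ∇3 : ∀ x y → (x ∨ y) ∧ (x ∨ y ∇) ≡ x

module WDLNotions {ℓ : Level} (W : WDL ℓ) where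
  open WDL W

  _⊓̄_ : Op₂ Carrier
  x ⊓̄ y = ((x Δ) ∨ (y Δ)) Δ

  S̄ : Pred Carrier ℓ
  S̄ x = (x Δ) Δ ≡ x

  record IsFilter (F : Pred Carrier ℓ) : Set ℓ where
    field
      nonempty : ∃[ x ] (x ∈ F)
      upward   : ∀ {x y} → x ∈ F → x ≤ y → y ∈ F
      ∧-closed : ∀ {x y} → x ∈ F → y ∈ F → (x ∧ y) ∈ F

  record IsSFilter (F : Pred Carrier ℓ) : Set ℓ where
    field
      isFilter : IsFilter F
      ⊓̄-closed : ∀ {x y} → x ∈ F → y ∈ F → (x ⊓̄ y) ∈ F

  data ⟨_⟩ (P : Pred Carrier ℓ) : Pred Carrier ℓ where
    gen  : ∀ {x}   → x ∈ P → x ∈ ⟨ P ⟩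
    up   : ∀ {x y} → x ∈ ⟨ P ⟩ → x ≤ y → y ∈ ⟨ P ⟩
    meet : ∀ {x y} → x ∈ ⟨ P ⟩ → y ∈ ⟨ P ⟩ → (x ∧ y) ∈ ⟨ P ⟩
    sq   : ∀ {x y} → x ∈ ⟨ P ⟩ → y ∈ ⟨ P ⟩ → (x ⊓̄ y) ∈ ⟨ P ⟩

  S[_⟩ : Carrier → Pred Carrier ℓ
  S[ a ⟩ = ⟨ ｛ a ｝ ⟩

  _⊻_ : Pred Carrier ℓ → Pred Carrier ℓ → Pred Carrier ℓ
  F ⊻ G = ⟨ F ∪ G ⟩

  IsPrincipalS : Pred Carrier ℓ → Set ℓ
  IsPrincipalS F = ∃[ a ] (F ≐ S[ a ⟩)

  SFp : Set (suc ℓ)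
  SFp = Σ (Pred Carrier ℓ) IsPrincipalS

  _≈SF_ : Rel SFp ℓ
  F ≈SF G = proj₁ F ≐ proj₁ G

  -- S[a)^⊥ = S[aΔ)  (defined via the chosen generator; well-definedness is
  -- the congruence field ⊥-cong of IsOrtholattice)
  _⊥SF : Op₁ SFp
  (F , a , _) ⊥SF = S[ a Δ ⟩ , a Δ , (λ z → z) , (λ z → z)

  𝟘SF 𝟙SF : SFp
  𝟘SF = S[ 𝟙 ⟩ , 𝟙 , (λ z → z) , (λ z → z)
  𝟙SF = S[ 𝟘 ⟩ , 𝟘 , (λ z → z) , (λ z → z)

  module SFpOps (∩-closed : (F G : SFp) → IsPrincipalS (proj₁ F ∩ proj₁ G))
                (⊻-closed : (F G : SFp) → IsPrincipalS (proj₁ F ⊻ proj₁ G)) where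
    _∩SF_ _⊻SF_ : Op₂ SFp
    F ∩SF G = (proj₁ F ∩ proj₁ G) , ∩-closed F G
    F ⊻SF G = (proj₁ F ⊻ proj₁ G) , ⊻-closed F G

  S̄Car : Set ℓ
  S̄Car = Σ Carrier S̄

  _≈S̄_ : Rel S̄Car ℓ
  x ≈S̄ y = proj₁ x ≡ proj₁ y

  module S̄Ops (⊓̄-closed : ∀ {x y} → x ∈ S̄ → y ∈ S̄ → (x ⊓̄ y) ∈ S̄)
              (∨-closed : ∀ {x y} → x ∈ S̄ → y ∈ S̄ → (x ∨ y) ∈ S̄)
              (Δ-closed : ∀ {x} → x ∈ S̄ → (x Δ) ∈ S̄)
              (𝟘-in : 𝟘 ∈ S̄) (𝟙-in : 𝟙 ∈ S̄) where
    _⊓̄S̄_ _∨S̄_ : Op₂ S̄Car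
    (x , p) ⊓̄S̄ (y , q) = x ⊓̄ y , ⊓̄-closed p q
    (x , p) ∨S̄ (y , q) = x ∨ y , ∨-closed p q
    _ΔS̄ : Op₁ S̄Car
    (x , p) ΔS̄ = x Δ , Δ-closed p
    𝟘S̄ 𝟙S̄ : S̄Car
    𝟘S̄ = 𝟘 , 𝟘-in
    𝟙S̄ = 𝟙 , 𝟙-in

  record Theorem4p12 : Set (suc ℓ) where
    field
      S[1⟩≐｛1｝ : S[ 𝟙 ⟩ ≐ ｛ 𝟙 ｝
      S[0⟩≐L    : S[ 𝟘 ⟩ ≐ U
      ∩-closed : (F G : SFp) → IsPrincipalS (proj₁ F ∩ proj₁ G)
      ⊻-closed : (F G : SFp) → IsPrincipalS (proj₁ F ⊻ proj₁ G)
    open SFpOps ∩-closed ⊻-closed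
    field
      SFp-ortholattice : IsOrtholattice _≈SF_ _∩SF_ _⊻SF_ _⊥SF 𝟘SF 𝟙SF
      S̄-⊓̄-closed : ∀ {x y} → x ∈ S̄ → y ∈ S̄ → (x ⊓̄ y) ∈ S̄
      S̄-∨-closed : ∀ {x y} → x ∈ S̄ → y ∈ S̄ → (x ∨ y) ∈ S̄
      S̄-Δ-closed : ∀ {x} → x ∈ S̄ → (x Δ) ∈ S̄
      S̄-𝟘 : 𝟘 ∈ S̄
      S̄-𝟙 : 𝟙 ∈ S̄
    open S̄Ops S̄-⊓̄-closed S̄-∨-closed S̄-Δ-closed S̄-𝟘 S̄-𝟙
    field
      iso    : S̄Car → SFp
      isIso  : IsOrthoIso _≈S̄_ _⊓̄S̄_ _∨S̄_ _ΔS̄ 𝟘S̄ 𝟙S̄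
                          _≈SF_ _∩SF_ _⊻SF_ _⊥SF 𝟘SF 𝟙SF iso

{-# OPTIONS --safe #-}
-- Every principal S-filter is a principal up-set: S[a) = ↑ aΔΔ. Indeed
-- aΔΔ = a ⊓̄ a lies in S[a), and the up-set of an element s of S̄(L) is
-- already an S-filter, because s ≤ x, y implies s = sΔΔ ≤ (xΔ ∨ yΔ)Δ = x ⊓̄ y.
-- So F ↦ min F is a bijection SF_p(L) → S̄(L) sending ∩ to ∨ and ⊻ to ⊓̄;
-- followed by Δ it becomes an isomorphism onto (S̄(L); ⊓̄, ∨, Δ, 0, 1). The
-- latter is an ortholattice (x ∨ xΔ = 1 is the axiom Δ3 at 1), and the
-- ortholattice laws pull back along the isomorphism to SF_p(L).
module Submission where

open import Defs
open import Level using (Level)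
open import Algebra.Core using (Op₁; Op₂)
open import Algebra.Lattice.Bundles using (Lattice)
open import Algebra.Lattice.Structures using (IsLattice)
open import Algebra.Lattice.Morphism.Structures using (IsLatticeMonomorphism)
import Algebra.Lattice.Morphism.LatticeMonomorphism as LatticeMonomorphism
import Algebra.Lattice.Properties.Lattice as LatticeProperties
open import Data.Product using (_,_; proj₁; proj₂)
open import Data.Sum using (inj₁; inj₂)
open import Data.Unit using (tt)
open import Relation.Binary.Bundles using (Setoid)
open import Relation.Binary.Core using (Rel)
import Relation.Binary.Construct.On as On
import Relation.Binary.Lattice as OrderTheoretic
import Relation.Binary.Reasoning.Setoid as SetoidReasoning
open import Relation.Binary.PropositionalEquality
  using (_≡_; refl; sym; trans; cong; cong₂; subst; module ≡-Reasoning)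
  renaming (isEquivalence to ≡-isEquivalence)
open import Relation.Unary using (Pred; _∈_; _⊆_; _≐_; _∩_; _∪_; ｛_｝; U)
open import Relation.Unary.Properties using (≐-refl; ≐-sym; ≐-trans)

module _ {a ℓa b ℓb} {A : Set a} {B : Set b}
         {_≈A_ : Rel A ℓa} {_∧A_ _∨A_ : Op₂ A} {_⊥A : Op₁ A} {𝟘A 𝟙A : A}
         {_≈B_ : Rel B ℓb} {_∧B_ _∨B_ : Op₂ B} {_⊥B : Op₁ B} {𝟘B 𝟙B : B}
         (B-isOrtholattice : IsOrtholattice _≈B_ _∧B_ _∨B_ _⊥B 𝟘B 𝟙B)
         {f : A → B}
         (f-isOrthoIso : IsOrthoIso _≈A_ _∧A_ _∨A_ _⊥A 𝟘A 𝟙A _≈B_ _∧B_ _∨B_ _⊥B 𝟘B 𝟙B f)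
         where

  private
    module B where
      open IsOrtholattice B-isOrtholattice public
      open IsLattice isLattice public
    open IsOrthoIso f-isOrthoIso renaming (cong to f-cong)

    B-setoid : Setoid b ℓb
    B-setoid = record { isEquivalence = B.isEquivalence }

    open SetoidReasoning B-setoid

    f-isLatticeMonomorphism :
      IsLatticeMonomorphism (record { _≈_ = _≈A_ ; _∨_ = _∨A_ ; _∧_ = _∧A_ })
                            (record { _≈_ = _≈B_ ; _∨_ = _∨B_ ; _∧_ = _∧B_ }) f
    f-isLatticeMonomorphism = record
      { isLatticeHomomorphism = record
          { isRelHomomorphism = record { cong = f-cong }
          ; ∧-homo            = hom-∧
          ; ∨-homo            = hom-∨
          }
      ; injective = injective
      }

  isOrtholattice-pullback : IsOrtholattice _≈A_ _∧A_ _∨A_ _⊥A 𝟘A 𝟙A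
  isOrtholattice-pullback = record
    { isLattice    = LatticeMonomorphism.isLattice f-isLatticeMonomorphism B.isLattice
    ; ⊥-cong       = ⊥-cong
    ; 𝟘-least      = 𝟘-least
    ; 𝟙-greatest   = 𝟙-greatest
    ; ⊥-involutive = ⊥-involutive
    ; ⊥-antitone   = ⊥-antitone
    ; ∨-complement = ∨-complement
    ; ∧-complement = ∧-complement
    }
    where
    ⊥-cong : ∀ {x y} → x ≈A y → (x ⊥A) ≈A (y ⊥A)
    ⊥-cong {x} {y} x≈y = injective (begin
      f (x ⊥A)   ≈⟨ hom-⊥ x ⟩
      (f x ⊥B)   ≈⟨ B.⊥-cong (f-cong x≈y) ⟩
      (f y ⊥B)   ≈⟨ hom-⊥ y ⟨
      f (y ⊥A)   ∎)

    𝟘-least : ∀ x → (𝟘A ∧A x) ≈A 𝟘A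
    𝟘-least x = injective (begin
      f (𝟘A ∧A x)     ≈⟨ hom-∧ 𝟘A x ⟩
      (f 𝟘A ∧B f x)   ≈⟨ B.∧-congʳ hom-𝟘 ⟩
      (𝟘B ∧B f x)     ≈⟨ B.𝟘-least (f x) ⟩
      𝟘B              ≈⟨ hom-𝟘 ⟨
      f 𝟘A            ∎)

    𝟙-greatest : ∀ x → (x ∧A 𝟙A) ≈A x
    𝟙-greatest x = injective (begin
      f (x ∧A 𝟙A)     ≈⟨ hom-∧ x 𝟙A ⟩
      (f x ∧B f 𝟙A)   ≈⟨ B.∧-congˡ hom-𝟙 ⟩
      (f x ∧B 𝟙B)     ≈⟨ B.𝟙-greatest (f x) ⟩
      f x             ∎)

    ⊥-involutive : ∀ x → ((x ⊥A) ⊥A) ≈A x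
    ⊥-involutive x = injective (begin
      f ((x ⊥A) ⊥A)   ≈⟨ hom-⊥ (x ⊥A) ⟩
      (f (x ⊥A) ⊥B)   ≈⟨ B.⊥-cong (hom-⊥ x) ⟩
      ((f x ⊥B) ⊥B)   ≈⟨ B.⊥-involutive (f x) ⟩
      f x             ∎)

    ⊥-antitone : ∀ x y → (x ∧A y) ≈A x → ((y ⊥A) ∧A (x ⊥A)) ≈A (y ⊥A)
    ⊥-antitone x y x∧y≈x = injective (begin
      f ((y ⊥A) ∧A (x ⊥A))       ≈⟨ hom-∧ (y ⊥A) (x ⊥A) ⟩
      (f (y ⊥A) ∧B f (x ⊥A))     ≈⟨ B.∧-cong (hom-⊥ y) (hom-⊥ x) ⟩
      ((f y ⊥B) ∧B (f x ⊥B))     ≈⟨ B.⊥-antitone (f x) (f y) fx∧fy≈fx ⟩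
      (f y ⊥B)                   ≈⟨ hom-⊥ y ⟨
      f (y ⊥A)                   ∎)
      where
      fx∧fy≈fx : (f x ∧B f y) ≈B f x
      fx∧fy≈fx = B.trans (B.sym (hom-∧ x y)) (f-cong x∧y≈x)

    ∨-complement : ∀ x → (x ∨A (x ⊥A)) ≈A 𝟙A
    ∨-complement x = injective (begin
      f (x ∨A (x ⊥A))     ≈⟨ hom-∨ x (x ⊥A) ⟩
      (f x ∨B f (x ⊥A))   ≈⟨ B.∨-congˡ (hom-⊥ x) ⟩
      (f x ∨B (f x ⊥B))   ≈⟨ B.∨-complement (f x) ⟩
      𝟙B                  ≈⟨ hom-𝟙 ⟨
      f 𝟙A                ∎)

    ∧-complement : ∀ x → (x ∧A (x ⊥A)) ≈A 𝟘A
    ∧-complement x = injective (begin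
      f (x ∧A (x ⊥A))     ≈⟨ hom-∧ x (x ⊥A) ⟩
      (f x ∧B f (x ⊥A))   ≈⟨ B.∧-congˡ (hom-⊥ x) ⟩
      (f x ∧B (f x ⊥B))   ≈⟨ B.∧-complement (f x) ⟩
      𝟘B                  ≈⟨ hom-𝟘 ⟨
      f 𝟘A                ∎)

  f⁻¹ : B → A
  f⁻¹ y = proj₁ (surjective y)

  f⁻¹-isOrthoIso : IsOrthoIso _≈B_ _∧B_ _∨B_ _⊥B 𝟘B 𝟙B _≈A_ _∧A_ _∨A_ _⊥A 𝟘A 𝟙A f⁻¹
  f⁻¹-isOrthoIso = record
    { cong       = λ y≈z → injective (B.trans (f∘f⁻¹ _) (B.trans y≈z (B.sym (f∘f⁻¹ _))))
    ; injective  = λ f⁻¹y≈f⁻¹z →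
        B.trans (B.sym (f∘f⁻¹ _)) (B.trans (f-cong f⁻¹y≈f⁻¹z) (f∘f⁻¹ _))
    ; surjective = λ x → f x , injective (f∘f⁻¹ (f x))
    ; hom-∧      = f⁻¹-homo₂ _∧A_ _∧B_ hom-∧ B.∧-cong
    ; hom-∨      = f⁻¹-homo₂ _∨A_ _∨B_ hom-∨ B.∨-cong
    ; hom-⊥      = λ y → injective (begin
        f (f⁻¹ (y ⊥B))     ≈⟨ f∘f⁻¹ (y ⊥B) ⟩
        (y ⊥B)             ≈⟨ B.⊥-cong (f∘f⁻¹ y) ⟨
        (f (f⁻¹ y) ⊥B)     ≈⟨ hom-⊥ (f⁻¹ y) ⟨
        f (f⁻¹ y ⊥A)       ∎)
    ; hom-𝟘      = injective (B.trans (f∘f⁻¹ 𝟘B) (B.sym hom-𝟘))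
    ; hom-𝟙      = injective (B.trans (f∘f⁻¹ 𝟙B) (B.sym hom-𝟙))
    }
    where
    f∘f⁻¹ : ∀ y → f (f⁻¹ y) ≈B y
    f∘f⁻¹ y = proj₂ (surjective y)

    f⁻¹-homo₂ : (_∙A_ : Op₂ A) (_∙B_ : Op₂ B) → (∀ x y → f (x ∙A y) ≈B (f x ∙B f y)) →
                (∀ {y y′ z z′} → y ≈B y′ → z ≈B z′ → (y ∙B z) ≈B (y′ ∙B z′)) →
                ∀ y z → f⁻¹ (y ∙B z) ≈A (f⁻¹ y ∙A f⁻¹ z)
    f⁻¹-homo₂ _∙A_ _∙B_ homo ∙B-cong y z = injective (begin
      f (f⁻¹ (y ∙B z))           ≈⟨ f∘f⁻¹ (y ∙B z) ⟩
      (y ∙B z)                   ≈⟨ ∙B-cong (f∘f⁻¹ y) (f∘f⁻¹ z) ⟨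
      (f (f⁻¹ y) ∙B f (f⁻¹ z))   ≈⟨ homo (f⁻¹ y) (f⁻¹ z) ⟨
      f (f⁻¹ y ∙A f⁻¹ z)         ∎)

module WDLProperties {ℓ : Level} (W : WDL ℓ) where
  open WDL W
  open WDLNotions W
  open IsLattice isLattice using (∨-comm; ∨-assoc; ∧-comm)
  open ≡-Reasoning

  private
    lattice : Lattice ℓ ℓ
    lattice = record { isLattice = isLattice }

    open LatticeProperties lattice using (∨-idem; ∨-∧-orderTheoreticLattice)

    -- The library orders a lattice by x ≡ x ∧ y, the mirror image of WDL._≤_.
    module ≼ = OrderTheoretic.Lattice ∨-∧-orderTheoreticLattice

  ≤-refl : ∀ {x} → x ≤ x
  ≤-refl = sym ≼.refl

  ≤-trans : ∀ {x y z} → x ≤ y → y ≤ z → x ≤ z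
  ≤-trans x≤y y≤z = sym (≼.trans (sym x≤y) (sym y≤z))

  ≤-antisym : ∀ {x y} → x ≤ y → y ≤ x → x ≡ y
  ≤-antisym x≤y y≤x = ≼.antisym (sym x≤y) (sym y≤x)

  x≤x∨y : ∀ x y → x ≤ x ∨ y
  x≤x∨y x y = sym (≼.x≤x∨y x y)

  y≤x∨y : ∀ x y → y ≤ x ∨ y
  y≤x∨y x y = sym (≼.y≤x∨y x y)

  ∨-least : ∀ {x y z} → x ≤ z → y ≤ z → x ∨ y ≤ z
  ∨-least x≤z y≤z = sym (≼.∨-least (sym x≤z) (sym y≤z))

  ∧-greatest : ∀ {x y z} → x ≤ y → x ≤ z → x ≤ y ∧ z
  ∧-greatest x≤y x≤z = sym (≼.∧-greatest (sym x≤y) (sym x≤z))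

  x≤y⇒x∨y≡y : ∀ {x y} → x ≤ y → x ∨ y ≡ y
  x≤y⇒x∨y≡y {x} {y} x≤y = ≤-antisym (∨-least x≤y ≤-refl) (y≤x∨y x y)

  x∨xΔ≡𝟙 : ∀ x → x ∨ x Δ ≡ 𝟙
  x∨xΔ≡𝟙 x = begin
    x ∨ x Δ                ≡⟨ cong₂ _∨_ (𝟙∧ x) (𝟙∧ (x Δ)) ⟨
    𝟙 ∧ x ∨ 𝟙 ∧ x Δ        ≡⟨ Δ3 𝟙 x ⟩
    𝟙                      ∎
    where
    𝟙∧ : ∀ y → 𝟙 ∧ y ≡ y
    𝟙∧ y = trans (∧-comm 𝟙 y) (𝟙-greatest y)

  Δ∈S̄ : ∀ x → x Δ ∈ S̄
  Δ∈S̄ x = ≤-antisym (Δ1 (x Δ)) (Δ2 _ _ (Δ1 x))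

  Δ-injectiveOnS̄ : ∀ {s t} → s ∈ S̄ → t ∈ S̄ → s Δ ≡ t Δ → s ≡ t
  Δ-injectiveOnS̄ s∈S̄ t∈S̄ sΔ≡tΔ = trans (sym s∈S̄) (trans (cong _Δ sΔ≡tΔ) t∈S̄)

  𝟘Δ≡𝟙 : 𝟘 Δ ≡ 𝟙
  𝟘Δ≡𝟙 = trans (sym (x≤y⇒x∨y≡y (𝟘-least (𝟘 Δ)))) (x∨xΔ≡𝟙 𝟘)

  𝟙Δ≡𝟘 : 𝟙 Δ ≡ 𝟘
  𝟙Δ≡𝟘 = ≤-antisym (subst (λ z → z Δ ≤ 𝟘) 𝟘Δ≡𝟙 (Δ1 𝟘)) (𝟘-least (𝟙 Δ))

  𝟘∈S̄ : 𝟘 ∈ S̄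
  𝟘∈S̄ = ≤-antisym (Δ1 𝟘) (𝟘-least _)

  𝟙∈S̄ : 𝟙 ∈ S̄
  𝟙∈S̄ = trans (cong _Δ 𝟙Δ≡𝟘) 𝟘Δ≡𝟙

  ≤⇒≤ΔΔ : ∀ {s x} → s ∈ S̄ → s ≤ x → s ≤ x Δ Δ
  ≤⇒≤ΔΔ s∈S̄ s≤x = subst (_≤ _) s∈S̄ (Δ2 _ _ (Δ2 _ _ s≤x))

  ∨∈S̄ : ∀ {x y} → x ∈ S̄ → y ∈ S̄ → x ∨ y ∈ S̄
  ∨∈S̄ {x} {y} x∈S̄ y∈S̄ = ≤-antisym (Δ1 (x ∨ y))
    (∨-least (≤⇒≤ΔΔ x∈S̄ (x≤x∨y x y)) (≤⇒≤ΔΔ y∈S̄ (y≤x∨y x y)))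

  ⊓̄∈S̄ : ∀ x y → x ⊓̄ y ∈ S̄
  ⊓̄∈S̄ x y = Δ∈S̄ (x Δ ∨ y Δ)

  ⊓̄-Δ : ∀ x y → (x ⊓̄ y) Δ ≡ x Δ ∨ y Δ
  ⊓̄-Δ x y = ∨∈S̄ (Δ∈S̄ x) (Δ∈S̄ y)

  ⊓̄-comm : ∀ x y → x ⊓̄ y ≡ y ⊓̄ x
  ⊓̄-comm x y = cong _Δ (∨-comm (x Δ) (y Δ))

  ⊓̄-assoc : ∀ x y z → (x ⊓̄ y) ⊓̄ z ≡ x ⊓̄ (y ⊓̄ z)
  ⊓̄-assoc x y z = cong _Δ (begin
    (x ⊓̄ y) Δ ∨ z Δ        ≡⟨ cong (_∨ z Δ) (⊓̄-Δ x y) ⟩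
    (x Δ ∨ y Δ) ∨ z Δ      ≡⟨ ∨-assoc (x Δ) (y Δ) (z Δ) ⟩
    x Δ ∨ (y Δ ∨ z Δ)      ≡⟨ cong (x Δ ∨_) (⊓̄-Δ y z) ⟨
    x Δ ∨ (y ⊓̄ z) Δ        ∎)

  ⊓̄≤ˡ : ∀ {s t} → s ∈ S̄ → s ⊓̄ t ≤ s
  ⊓̄≤ˡ {s} {t} s∈S̄ = subst (s ⊓̄ t ≤_) s∈S̄ (Δ2 _ _ (x≤x∨y (s Δ) (t Δ)))

  ⊓̄≤ʳ : ∀ {s t} → t ∈ S̄ → s ⊓̄ t ≤ t
  ⊓̄≤ʳ {s} {t} t∈S̄ = subst (_≤ t) (⊓̄-comm t s) (⊓̄≤ˡ t∈S̄)

  ⊓̄-greatest : ∀ {s x y} → s ∈ S̄ → s ≤ x → s ≤ y → s ≤ x ⊓̄ y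
  ⊓̄-greatest s∈S̄ s≤x s≤y = subst (_≤ _) s∈S̄ (Δ2 _ _ (∨-least (Δ2 _ _ s≤x) (Δ2 _ _ s≤y)))

  ≤⇒⊓̄≡ : ∀ {s t} → s ∈ S̄ → s ≤ t → s ⊓̄ t ≡ s
  ≤⇒⊓̄≡ {s} {t} s∈S̄ s≤t =
    trans (cong _Δ (trans (∨-comm (s Δ) (t Δ)) (x≤y⇒x∨y≡y (Δ2 _ _ s≤t)))) s∈S̄

  S̄-⊓̄-closed : ∀ {x y} → x ∈ S̄ → y ∈ S̄ → x ⊓̄ y ∈ S̄
  S̄-⊓̄-closed {x} {y} _ _ = ⊓̄∈S̄ x y

  S̄-Δ-closed : ∀ {x} → x ∈ S̄ → x Δ ∈ S̄
  S̄-Δ-closed {x} _ = Δ∈S̄ x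

  open S̄Ops S̄-⊓̄-closed ∨∈S̄ S̄-Δ-closed 𝟘∈S̄ 𝟙∈S̄

  S̄-isLattice : IsLattice _≈S̄_ _∨S̄_ _⊓̄S̄_
  S̄-isLattice = record
    { isEquivalence = On.isEquivalence proj₁ ≡-isEquivalence
    ; ∨-comm        = λ (x , _) (y , _) → ∨-comm x y
    ; ∨-assoc       = λ (x , _) (y , _) (z , _) → ∨-assoc x y z
    ; ∨-cong        = cong₂ _∨_
    ; ∧-comm        = λ (x , _) (y , _) → ⊓̄-comm x y
    ; ∧-assoc       = λ (x , _) (y , _) (z , _) → ⊓̄-assoc x y z
    ; ∧-cong        = cong₂ _⊓̄_
    ; absorptive    = (λ (s , s∈S̄) (t , _) → trans (∨-comm s (s ⊓̄ t)) (x≤y⇒x∨y≡y (⊓̄≤ˡ s∈S̄)))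
                    , (λ (s , s∈S̄) (t , _) → ≤⇒⊓̄≡ s∈S̄ (x≤x∨y s t))
    }

  S̄-isOrtholattice : IsOrtholattice _≈S̄_ _⊓̄S̄_ _∨S̄_ _ΔS̄ 𝟘S̄ 𝟙S̄
  S̄-isOrtholattice = record
    { isLattice    = S̄-isLattice
    ; ⊥-cong       = cong _Δ
    ; 𝟘-least      = λ (x , _) → ≤⇒⊓̄≡ 𝟘∈S̄ (𝟘-least x)
    ; 𝟙-greatest   = λ (x , x∈S̄) → ≤⇒⊓̄≡ x∈S̄ (𝟙-greatest x)
    ; ⊥-involutive = λ (_ , x∈S̄) → x∈S̄
    ; ⊥-antitone   = λ (x , _) (y , y∈S̄) x⊓̄y≡x →
        ≤⇒⊓̄≡ (Δ∈S̄ y) (Δ2 x y (subst (_≤ y) x⊓̄y≡x (⊓̄≤ʳ y∈S̄)))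
    ; ∨-complement = λ (x , _) → x∨xΔ≡𝟙 x
    ; ∧-complement = λ (x , _) → trans (cong _Δ (x∨xΔ≡𝟙 (x Δ))) 𝟙Δ≡𝟘
    }

  infix 9 ↑_
  ↑_ : Carrier → Pred Carrier ℓ
  ↑ s = s ≤_

  ↑-injective : ∀ {s t} → ↑ s ≐ ↑ t → s ≡ t
  ↑-injective (↑s⊆↑t , ↑t⊆↑s) = ≤-antisym (↑t⊆↑s ≤-refl) (↑s⊆↑t ≤-refl)

  ↑𝟙≐｛𝟙｝ : ↑ 𝟙 ≐ ｛ 𝟙 ｝
  ↑𝟙≐｛𝟙｝ = (λ {x} 𝟙≤x → ≤-antisym 𝟙≤x (𝟙-greatest x)) , λ { refl → ≤-refl }

  ↑𝟘≐U : ↑ 𝟘 ≐ U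
  ↑𝟘≐U = (λ _ → tt) , λ {x} _ → 𝟘-least x

  ⟨⟩⊆↑ : ∀ {R s} → s ∈ S̄ → R ⊆ ↑ s → ⟨ R ⟩ ⊆ ↑ s
  ⟨⟩⊆↑ s∈S̄ R⊆↑s (gen x∈R)    = R⊆↑s x∈R
  ⟨⟩⊆↑ s∈S̄ R⊆↑s (up x∈ x≤y)  = ≤-trans (⟨⟩⊆↑ s∈S̄ R⊆↑s x∈) x≤y
  ⟨⟩⊆↑ s∈S̄ R⊆↑s (meet x∈ y∈) = ∧-greatest (⟨⟩⊆↑ s∈S̄ R⊆↑s x∈) (⟨⟩⊆↑ s∈S̄ R⊆↑s y∈)
  ⟨⟩⊆↑ s∈S̄ R⊆↑s (sq x∈ y∈)   = ⊓̄-greatest s∈S̄ (⟨⟩⊆↑ s∈S̄ R⊆↑s x∈) (⟨⟩⊆↑ s∈S̄ R⊆↑s y∈)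

  ΔΔ∈S[⟩ : ∀ a → a Δ Δ ∈ S[ a ⟩
  ΔΔ∈S[⟩ a = subst (_∈ S[ a ⟩) (cong _Δ (∨-idem (a Δ))) (sq (gen refl) (gen refl))

  S[⟩≐↑ΔΔ : ∀ a → S[ a ⟩ ≐ ↑ a Δ Δ
  S[⟩≐↑ΔΔ a = ⟨⟩⊆↑ (Δ∈S̄ (a Δ)) (λ { refl → Δ1 a }) , up (ΔΔ∈S[⟩ a)

  S[⟩≐↑ : ∀ {s} → s ∈ S̄ → S[ s ⟩ ≐ ↑ s
  S[⟩≐↑ {s} s∈S̄ = subst (λ t → S[ s ⟩ ≐ ↑ t) s∈S̄ (S[⟩≐↑ΔΔ s)

  ∩-≐↑ : ∀ {P Q : Pred Carrier ℓ} {s t} → P ≐ ↑ s → Q ≐ ↑ t → P ∩ Q ≐ ↑ (s ∨ t)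
  ∩-≐↑ {s = s} {t} (P⊆↑s , ↑s⊆P) (Q⊆↑t , ↑t⊆Q) =
    (λ (x∈P , x∈Q) → ∨-least (P⊆↑s x∈P) (Q⊆↑t x∈Q)) ,
    (λ s∨t≤x → ↑s⊆P (≤-trans (x≤x∨y s t) s∨t≤x) , ↑t⊆Q (≤-trans (y≤x∨y s t) s∨t≤x))

  ⊻-≐↑ : ∀ {P Q s t} → s ∈ S̄ → t ∈ S̄ → P ≐ ↑ s → Q ≐ ↑ t → P ⊻ Q ≐ ↑ (s ⊓̄ t)
  ⊻-≐↑ {P} {Q} {s} {t} s∈S̄ t∈S̄ (P⊆↑s , ↑s⊆P) (Q⊆↑t , ↑t⊆Q) =
    ⟨⟩⊆↑ (⊓̄∈S̄ s t) P∪Q⊆↑s⊓̄t ,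
    up (sq (gen (inj₁ (↑s⊆P ≤-refl))) (gen (inj₂ (↑t⊆Q ≤-refl))))
    where
    P∪Q⊆↑s⊓̄t : P ∪ Q ⊆ ↑ (s ⊓̄ t)
    P∪Q⊆↑s⊓̄t (inj₁ x∈P) = ≤-trans (⊓̄≤ˡ s∈S̄) (P⊆↑s x∈P)
    P∪Q⊆↑s⊓̄t (inj₂ x∈Q) = ≤-trans (⊓̄≤ʳ t∈S̄) (Q⊆↑t x∈Q)

  least : SFp → Carrier
  least (_ , a , _) = a Δ Δ

  least∈S̄ : ∀ F → least F ∈ S̄
  least∈S̄ (_ , a , _) = Δ∈S̄ (a Δ)

  SFp≐↑least : ∀ F → proj₁ F ≐ ↑ least F
  SFp≐↑least (_ , a , F≐S[a⟩) = ≐-trans F≐S[a⟩ (S[⟩≐↑ΔΔ a)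

  ≈SF⇒least≡ : ∀ F G → F ≈SF G → least F ≡ least G
  ≈SF⇒least≡ F G F≐G = ↑-injective (≐-trans (≐-sym (SFp≐↑least F)) (≐-trans F≐G (SFp≐↑least G)))

  least≡⇒≈SF : ∀ F G → least F ≡ least G → F ≈SF G
  least≡⇒≈SF F G leastF≡leastG =
    ≐-trans (SFp≐↑least F) (subst (λ s → ↑ s ≐ proj₁ G) (sym leastF≡leastG) (≐-sym (SFp≐↑least G)))

  ∩-closed : (F G : SFp) → IsPrincipalS (proj₁ F ∩ proj₁ G)
  ∩-closed F G = least F ∨ least G ,
    ≐-trans (∩-≐↑ (SFp≐↑least F) (SFp≐↑least G))
            (≐-sym (S[⟩≐↑ (∨∈S̄ (least∈S̄ F) (least∈S̄ G))))

  ⊻-closed : (F G : SFp) → IsPrincipalS (proj₁ F ⊻ proj₁ G)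
  ⊻-closed F G = least F ⊓̄ least G ,
    ≐-trans (⊻-≐↑ (least∈S̄ F) (least∈S̄ G) (SFp≐↑least F) (SFp≐↑least G))
            (≐-sym (S[⟩≐↑ (⊓̄∈S̄ (least F) (least G))))

  open SFpOps ∩-closed ⊻-closed

  toS̄ : SFp → S̄Car
  toS̄ (_ , a , _) = a Δ , Δ∈S̄ a

  toS̄-isOrthoIso : IsOrthoIso _≈SF_ _∩SF_ _⊻SF_ _⊥SF 𝟘SF 𝟙SF _≈S̄_ _⊓̄S̄_ _∨S̄_ _ΔS̄ 𝟘S̄ 𝟙S̄ toS̄
  toS̄-isOrthoIso = record
    { cong       = λ {F} {G} → toS̄-cong F G
    ; injective  = λ {F} {G} aΔ≡bΔ → least≡⇒≈SF F G (cong _Δ aΔ≡bΔ)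
    ; surjective = λ (s , s∈S̄) → (S[ s Δ ⟩ , s Δ , ≐-refl) , s∈S̄
    ; hom-∧      = λ _ _ → refl
    ; hom-∨      = toS̄-hom-∨
    ; hom-⊥      = λ _ → refl
    ; hom-𝟘      = 𝟙Δ≡𝟘
    ; hom-𝟙      = 𝟘Δ≡𝟙
    }
    where
    toS̄-cong : ∀ F G → F ≈SF G → toS̄ F ≈S̄ toS̄ G
    toS̄-cong F@(_ , a , _) G@(_ , b , _) F≈G =
      Δ-injectiveOnS̄ (Δ∈S̄ a) (Δ∈S̄ b) (≈SF⇒least≡ F G F≈G)

    toS̄-hom-∨ : ∀ F G → toS̄ (F ⊻SF G) ≈S̄ (toS̄ F ∨S̄ toS̄ G)
    toS̄-hom-∨ F@(_ , a , _) G@(_ , b , _) =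
      trans (⊓̄-Δ (least F) (least G)) (cong₂ _∨_ (Δ∈S̄ a) (Δ∈S̄ b))

theorem4p12 : ∀ {ℓ : Level} (W : WDL ℓ) → WDLNotions.Theorem4p12 W
theorem4p12 W = record
  { S[1⟩≐｛1｝        = ≐-trans (S[⟩≐↑ 𝟙∈S̄) ↑𝟙≐｛𝟙｝
  ; S[0⟩≐L           = ≐-trans (S[⟩≐↑ 𝟘∈S̄) ↑𝟘≐U
  ; ∩-closed         = ∩-closed
  ; ⊻-closed         = ⊻-closed
  ; SFp-ortholattice = isOrtholattice-pullback S̄-isOrtholattice toS̄-isOrthoIso
  ; S̄-⊓̄-closed       = S̄-⊓̄-closed
  ; S̄-∨-closed       = ∨∈S̄
  ; S̄-Δ-closed       = S̄-Δ-closed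
  ; S̄-𝟘              = 𝟘∈S̄
  ; S̄-𝟙              = 𝟙∈S̄
  ; iso              = f⁻¹ S̄-isOrtholattice toS̄-isOrthoIso
  ; isIso            = f⁻¹-isOrthoIso S̄-isOrtholattice toS̄-isOrthoIso
  }
  where open WDLProperties W
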